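{- Let $a_T: (\alpha_1,\alpha_2) \to (\beta_1,\beta_2)$ be an arrow in the Remmel--Whitney quiver that satisfies neither the $r^{th}$ row rule nor the reverse $r^{th}$ row rule. Then there are two arrows in the Remmel--Whitney quiver, \[(\alpha_1,\alpha_2) \xrightarrow{a_{T_1}} (\lambda_1,\lambda_2) \xrightarrow{a_{T_2}} (\beta_1,\beta_2),\] such that $a_{T_1}$ satisfies the $r^{th}$ row rule, $a_{T_2}$ satisfies the reverse $r^{th}$ row rule, and $T$ is the composition tableau of $T_1$ and $T_2$.
   Context: For a skew shape $\alpha/\beta$, the reverse lexicographic filling $\mathrm{rl}(\alpha/\beta)$ enters $1,\dots,|\alpha|-|\beta|$ from right to left along rows and from top to bottom. For skew shapes $\gamma/\delta$ and $\alpha/\beta$, the Remmel--Whitney set $\mathrm{RW}_{\gamma/\delta}(\alpha/\beta)$ is the set of standard skew tableaux $T$ of shape $\gamma/\delta$ such that: if $i$ and $i+1$ are in the same row of $\mathrm{rl}(\alpha/\beta)$ then $i+1$ is strictly to the right and weakly above $i$ in $T$; and if $i$ is directly above $j$ in the same column of $\mathrm{rl}(\alpha/\beta)$ then $j$ is strictly below and weakly left of $i$ in $T$. The Remmel--Whitney quiver has vertices all pairs of partitions, and for distinct vertices $(\alpha_1,\alpha_2)$, $(\beta_1,\beta_2)$ an arrow $a_T:(\alpha_1,\alpha_2)\to(\beta_1,\beta_2)$ for each $T\in \mathrm{RW}_{\beta_1/\alpha_1}(\alpha_2/\beta_2)$. Fix a positive integer $r$. The $r^{th}$ row rule filling of a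 partition places $r$ in the top left box, and increases by $1$ moving down a column and decreases by $1$ moving right along a row (e.g. for $(3,3,2)$ and $r=5$ the rows are $5,4,3$ / $6,5,4$ / $7,6$). For an arrow $a_T:(\alpha_1,\alpha_2)\to(\beta_1,\beta_2)$ and a label $i\in\{1,\dots,|\beta_1|-|\alpha_1|\}$, let $R_r(i)$ be the entry of the $r^{th}$ row rule filling (of $\alpha_2$, restricted to $\alpha_2/\beta_2$) in the box labeled $i$ in $\mathrm{rl}(\alpha_2/\beta_2)$, and let $\mathrm{row}_T(i)$ be the row in which $i$ appears in $T$. Then $T$ (or $a_T$) satisfies the $r^{th}$ row rule if $R_r(i)\le \mathrm{row}_T(i)$ for all $i$, and satisfies the reverse $r^{th}$ row rule if $R_r(i)>\mathrm{row}_T(i)$ for all $i$. Composition tableau: given a path $(\alpha_1,\alpha_2) \xrightarrow{a_{T_1}} (\lambda_1,\lambda_2) \xrightarrow{a_{T_2}} (\beta_1,\beta_2)$ (so $\alpha_1\subset\lambda_1\subset\beta_1$, $\beta_2\subset\lambda_2\subset\alpha_2$, $T_1\in\mathrm{RW}_{\lambda_1/\alpha_1}(\alpha_2/\lambda_2)$, $T_2\in\mathrm{RW}_{\beta_1/\lambda_1}(\lambda_2/\beta_2)$), the composition tableau $T$ of shape $\beta_1/\alpha_1$ is built as follows: a box $B_1$ of $\beta_1/\alpha_1$ lying in $\lambda_1/\alpha_1$ has a label in $T_1$, which determines via $\mathrm{rl}(\alpha_2/\lambda_2)$ a box $B_2$ of $\alpha_2/\lambda_2\subset\alpha_2/\beta_2$;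 label $B_1$ in $T$ by the label of $B_2$ in $\mathrm{rl}(\alpha_2/\beta_2)$. Boxes in $\beta_1/\lambda_1$ are treated the same way using $T_2$ and $\mathrm{rl}(\lambda_2/\beta_2)$. -}

module Defs where

open import Data.Nat using (ℕ; zero; suc; _+_; _∸_; _≤_; _<_; _≥_)
open import Data.Nat.Properties using ()
open import Data.List using (List; []; _∷_; map; concatMap; upTo; downFrom; length)
open import Data.Nat.ListAction using (sum)
open import Data.List.Relation.Unary.All using (All)
open import Data.List.Relation.Unary.Linked using (Linked)
open import Data.Product using (_×_; _,_; proj₁; proj₂; ∃; ∃-syntax)
open import Relation.Nullary using (¬_)
open import Relation.Binary.PropositionalEquality using (_≡_; _≢_)

IsPartition : List ℕ → Set
IsPartition λ′ = Linked _≥_ λ′ × All (λ x → 1 ≤ x) λ′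

rowLen : List ℕ → ℕ → ℕ
rowLen []       _       = 0
rowLen (x ∷ _)  zero    = x
rowLen (_ ∷ xs) (suc i) = rowLen xs i

size : List ℕ → ℕ
size = sum

-- Boxes: (row , column), both 0-indexed (row 0 is the top row).
Box : Set
Box = ℕ × ℕ

row col : Box → ℕ
row = proj₁
col = proj₂

InShape : List ℕ → Box → Set
InShape λ′ (i , j) = j < rowLen λ′ i

_⊆ₚ_ : List ℕ → List ℕ → Set
δ ⊆ₚ γ = ∀ i → rowLen δ i ≤ rowLen γ i

InSkew : List ℕ → List ℕ → Box → Set
InSkew γ δ b = InShape γ b × ¬ InShape δ b

skewSize : List ℕ → List ℕ → ℕ
skewSize γ δ = size γ ∸ size δ

InRange : ℕ → ℕ → Set
InRange n k = 1 ≤ k × k ≤ n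

-- Tableaux are represented by the position of each label:
-- T k is the box containing label k (only labels 1..n matter).

Tab : Set
Tab = ℕ → Box

StandardSkew : List ℕ → List ℕ → Tab → Set
StandardSkew γ δ T =
  let n = skewSize γ δ in
  (∀ k → InRange n k → InSkew γ δ (T k)) ×
  (∀ k l → InRange n k → InRange n l → T k ≡ T l → k ≡ l) ×
  (∀ b → InSkew γ δ b → ∃[ k ] (InRange n k × T k ≡ b)) ×
  (∀ k l → InRange n k → InRange n l →
     row (T k) ≡ row (T l) → col (T k) < col (T l) → k < l) ×
  (∀ k l → InRange n k → InRange n l →
     col (T k) ≡ col (T l) → row (T k) < row (T l) → k < l)

-- Reverse lexicographic filling rl(α/β): 1,2,… entered right to left
-- along rows, rows from top to bottom.

rowBoxesRL : ℕ → ℕ → ℕ → List Box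
rowBoxesRL a b i = map (λ t → (i , b + t)) (downFrom (a ∸ b))

rlList : List ℕ → List ℕ → List Box
rlList α β = concatMap (λ i → rowBoxesRL (rowLen α i) (rowLen β i) i) (upTo (length α))

at : List Box → ℕ → Box
at []       _       = (0 , 0)
at (x ∷ _)  zero    = x
at (_ ∷ xs) (suc k) = at xs k

rl : List ℕ → List ℕ → Tab
rl α β k = at (rlList α β) (k ∸ 1)

RW : List ℕ → List ℕ → List ℕ → List ℕ → Tab → Set
RW γ δ α β T =
  let n = skewSize α β in
  StandardSkew γ δ T ×
  skewSize γ δ ≡ n ×
  (∀ i → InRange n i → InRange n (suc i) →
     row (rl α β i) ≡ row (rl α β (suc i)) →
     col (T i) < col (T (suc i)) × row (T (suc i)) ≤ row (T i)) ×
  (∀ i j → InRange n i → InRange n j →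
     row (rl α β j) ≡ suc (row (rl α β i)) → col (rl α β j) ≡ col (rl α β i) →
     row (T i) < row (T j) × col (T j) ≤ col (T i))

Vertex : Set
Vertex = List ℕ × List ℕ

IsVertex : Vertex → Set
IsVertex (μ₁ , μ₂) = IsPartition μ₁ × IsPartition μ₂

Arrow : Vertex → Vertex → Tab → Set
Arrow (α₁ , α₂) (β₁ , β₂) T =
  IsVertex (α₁ , α₂) × IsVertex (β₁ , β₂) ×
  (α₁ , α₂) ≢ (β₁ , β₂) ×
  α₁ ⊆ₚ β₁ × β₂ ⊆ₚ α₂ ×
  RW β₁ α₁ α₂ β₂ T

-- With 0-indexed box (a , b) of α₂ the r-th row rule
-- filling has entry r + a - b; row_T(i) (1-indexed) is row (T i) + 1.
-- R ≤ row_T  ⇔  r + a ≤ row (T i) + 1 + b   (an inequality in ℤ, moved to ℕ).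

-- Here α₂ β₂ are the second components of source and target.
RowRule : ℕ → List ℕ → List ℕ → Tab → Set
RowRule r α₂ β₂ T =
  ∀ i → InRange (skewSize α₂ β₂) i →
    r + row (rl α₂ β₂ i) ≤ row (T i) + 1 + col (rl α₂ β₂ i)

RevRowRule : ℕ → List ℕ → List ℕ → Tab → Set
RevRowRule r α₂ β₂ T =
  ∀ i → InRange (skewSize α₂ β₂) i →
    row (T i) + 1 + col (rl α₂ β₂ i) < r + row (rl α₂ β₂ i)

-- Composition tableau of a path
--   (α₁,α₂) --T₁--> (λ₁,λ₂) --T₂--> (β₁,β₂)
-- T (shape β₁/α₁, labels from rl(α₂/β₂)) is the composition tableau:
-- the box of T₁ labelled j corresponds to the box B₂ = rl(α₂/λ₂)(j),
-- and carries in T the label k of B₂ in rl(α₂/β₂); similarly for T₂.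

IsComposition : (α₁ λ₁′ β₁ α₂ λ₂ β₂ : List ℕ) → Tab → Tab → Tab → Set
IsComposition α₁ λ₁′ β₁ α₂ λ₂ β₂ T₁ T₂ T =
  (∀ j k → InRange (skewSize λ₁′ α₁) j → InRange (skewSize α₂ β₂) k →
     rl α₂ λ₂ j ≡ rl α₂ β₂ k → T k ≡ T₁ j) ×
  (∀ j k → InRange (skewSize β₁ λ₁′) j → InRange (skewSize α₂ β₂) k →
     rl λ₂ β₂ j ≡ rl α₂ β₂ k → T k ≡ T₂ j)

-- Call a box b of α₂/β₂ good if the r-th row rule holds at its label: R_r(b) ≤ row_T(b).
-- Moving b one box right lowers R_r by one while (by the RW conditions) T moves weakly down;
-- moving b one box down raises R_r by one while T moves strictly down. So the good boxes are
-- closed rightwards and downwards, and α₂/λ₂ := {good boxes} cuts out a partition λ₂ between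
-- β₂ and α₂. In β₁/α₁ the images of good boxes are closed leftwards and upwards: comparing the
-- origins of two neighbouring cells, the RW conditions force the content col − row to drop,
-- which carries the row rule across. This gives λ₁ with λ₁/α₁ the images of the good boxes.
-- Restricting T to the two pieces yields T₁ ∈ RW_{λ₁/α₁}(α₂/λ₂) and T₂ ∈ RW_{β₁/λ₁}(λ₂/β₂),
-- composing to T; T₁ obeys the row rule and T₂ the reverse one by construction, and both arrows
-- are non-trivial because T obeys neither rule.
module Submission where

open import Defs
open import Data.Nat
open import Data.Nat.Properties
open import Data.Nat.ListAction using (sum)
open import Data.List using (List; []; _∷_; _++_; length; concat; applyUpTo; downFrom; map)
open import Data.List.Properties using (length-++; length-map; map-applyUpTo; length-applyDownFrom)
open import Data.List.Relation.Unary.All using (All; []; _∷_)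
open import Data.List.Relation.Unary.Linked using (Linked; []; [-]; _∷_)
open import Data.Fin using (Fin; toℕ; fromℕ<)
open import Data.Fin.Properties using (any?; injective⇒≤; toℕ<n; toℕ-fromℕ<; toℕ-injective)
open import Data.Product using (_×_; _,_; proj₁; proj₂; ∃-syntax)
open import Data.Product.Properties using (≡-dec)
open import Data.Sum using (_⊎_; inj₁; inj₂)
open import Data.Empty using (⊥; ⊥-elim)
open import Function using (_∘_; id)
open import Relation.Nullary using (¬_; yes; no; Dec)
open import Relation.Nullary.Decidable using (¬?; decidable-stable)
open import Relation.Binary.Definitions using (tri<; tri≈; tri>)
open import Relation.Binary.PropositionalEquality
open import Data.Nat.Solver using (module +-*-Solver)

sumTo : (ℕ → ℕ) → ℕ → ℕ
sumTo f n = sum (applyUpTo f n)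

sumTo-cong : ∀ {f g} → (∀ x → f x ≡ g x) → ∀ n → sumTo f n ≡ sumTo g n
sumTo-cong e zero    = refl
sumTo-cong e (suc n) = cong₂ _+_ (e 0) (sumTo-cong (e ∘ suc) n)

sumTo-suc : ∀ f n → sumTo f (suc n) ≡ sumTo f n + f n
sumTo-suc f zero    = +-identityʳ (f 0)
sumTo-suc f (suc n) = trans (cong (f 0 +_) (sumTo-suc (f ∘ suc) n)) (sym (+-assoc (f 0) _ _))

sumTo-monoʳ-≤ : ∀ f {m n} → m ≤ n → sumTo f m ≤ sumTo f n
sumTo-monoʳ-≤ f {zero}  _         = z≤n
sumTo-monoʳ-≤ f {suc m} (s≤s m≤n) = +-monoʳ-≤ (f 0) (sumTo-monoʳ-≤ (f ∘ suc) m≤n)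

sumTo-+ : ∀ f g n → sumTo (λ x → f x + g x) n ≡ sumTo f n + sumTo g n
sumTo-+ f g zero    = refl
sumTo-+ f g (suc n) = trans (cong (f 0 + g 0 +_) (sumTo-+ (f ∘ suc) (g ∘ suc) n))
                           (+-interchange (f 0) (g 0) _ _)
  where open import Algebra.Properties.CommutativeSemigroup +-commutativeSemigroup
          using () renaming (interchange to +-interchange)

at-++ˡ : ∀ xs ys {t} → t < length xs → at (xs ++ ys) t ≡ at xs t
at-++ˡ (x ∷ xs) ys {zero}  _         = refl
at-++ˡ (x ∷ xs) ys {suc t} (s≤s t<n) = at-++ˡ xs ys t<n

at-++ʳ : ∀ xs ys t → at (xs ++ ys) (length xs + t) ≡ at ys t
at-++ʳ []       ys t = refl
at-++ʳ (x ∷ xs) ys t = at-++ʳ xs ys t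

blockStart : (ℕ → List Box) → ℕ → ℕ
blockStart g = sumTo (length ∘ g)

length-concat-applyUpTo : ∀ g n → length (concat (applyUpTo g n)) ≡ blockStart g n
length-concat-applyUpTo g zero    = refl
length-concat-applyUpTo g (suc n) =
  trans (length-++ (g 0)) (cong (length (g 0) +_) (length-concat-applyUpTo (g ∘ suc) n))

at-concat-applyUpTo : ∀ g {n i u} → i < n → u < length (g i) →
  at (concat (applyUpTo g n)) (blockStart g i + u) ≡ at (g i) u
at-concat-applyUpTo g {suc n} {zero}  {u} _         u<len = at-++ˡ (g 0) _ u<len
at-concat-applyUpTo g {suc n} {suc i} {u} (s≤s i<n) u<len = begin
  at (g 0 ++ rest) (length (g 0) + blockStart (g ∘ suc) i + u)   ≡⟨ cong (at (g 0 ++ rest)) (+-assoc (length (g 0)) _ u) ⟩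
  at (g 0 ++ rest) (length (g 0) + (blockStart (g ∘ suc) i + u)) ≡⟨ at-++ʳ (g 0) rest _ ⟩
  at rest (blockStart (g ∘ suc) i + u)                           ≡⟨ at-concat-applyUpTo (g ∘ suc) i<n u<len ⟩
  at (g (suc i)) u                                               ∎
  where
  open ≡-Reasoning
  rest : List Box
  rest = concat (applyUpTo (g ∘ suc) n)

concat-applyUpTo-index : ∀ g n {t} → t < length (concat (applyUpTo g n)) →
  ∃[ i ] ∃[ u ] (i < n × u < length (g i) × t ≡ blockStart g i + u)
concat-applyUpTo-index g (suc n) {t} t<len with t <? length (g 0)
... | yes t<g₀ = 0 , t , s≤s z≤n , t<g₀ , refl
... | no  t≮g₀ with concat-applyUpTo-index (g ∘ suc) n rest<
  where
  t≡ : length (g 0) + (t ∸ length (g 0)) ≡ t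
  t≡ = m+[n∸m]≡n (≮⇒≥ t≮g₀)
  rest< : t ∸ length (g 0) < length (concat (applyUpTo (g ∘ suc) n))
  rest< = +-cancelˡ-< (length (g 0)) _ _ (subst₂ _<_ (sym t≡) (length-++ (g 0)) t<len)
... | i , u , i<n , u<len , t∸≡ =
  suc i , u , s≤s i<n , u<len ,
  trans (sym (m+[n∸m]≡n (≮⇒≥ t≮g₀))) (trans (cong (length (g 0) +_) t∸≡) (sym (+-assoc (length (g 0)) _ u)))

rowLen-beyond : ∀ μ {a} → length μ ≤ a → rowLen μ a ≡ 0
rowLen-beyond []      _         = refl
rowLen-beyond (_ ∷ μ) (s≤s μ≤a) = rowLen-beyond μ μ≤a

sumTo-rowLen : ∀ μ {n} → length μ ≤ n → sumTo (rowLen μ) n ≡ size μ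
sumTo-rowLen []      {n}     _         = sumTo-zero n
  where
  sumTo-zero : ∀ n → sumTo (λ _ → 0) n ≡ 0
  sumTo-zero zero    = refl
  sumTo-zero (suc n) = sumTo-zero n
sumTo-rowLen (x ∷ μ) {suc n} (s≤s μ≤n) = cong (x +_) (sumTo-rowLen μ μ≤n)

⊆ₚ⇒length≤ : ∀ {μ ν} → All (1 ≤_) μ → μ ⊆ₚ ν → length μ ≤ length ν
⊆ₚ⇒length≤ {[]}             _           _   = z≤n
⊆ₚ⇒length≤ {_ ∷ _} {[]}     (1≤x ∷ _)   μ⊆ν = ⊥-elim (n≮0 (≤-trans 1≤x (μ⊆ν 0)))
⊆ₚ⇒length≤ {_ ∷ _} {_ ∷ ν}  (_ ∷ μ-pos) μ⊆ν = s≤s (⊆ₚ⇒length≤ {ν = ν} μ-pos (μ⊆ν ∘ suc))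

Antitone : (ℕ → ℕ) → Set
Antitone L = ∀ a → L (suc a) ≤ L a

antitone-≤ : ∀ {L} → Antitone L → ∀ {a b} → a ≤ b → L b ≤ L a
antitone-≤ {L} L↓ {a} {b} a≤b with m≤n⇒m<n∨m≡n a≤b
... | inj₂ refl        = ≤-refl
antitone-≤ {L} L↓ {a} {suc b} _ | inj₁ (s≤s a≤b) = ≤-trans (L↓ b) (antitone-≤ L↓ a≤b)

linked⇒rowLen-antitone : ∀ μ → Linked _≥_ μ → Antitone (rowLen μ)
linked⇒rowLen-antitone []          _         _       = z≤n
linked⇒rowLen-antitone (_ ∷ [])    _         _       = z≤n
linked⇒rowLen-antitone (_ ∷ _ ∷ _) (x≥y ∷ _) zero    = x≥y
linked⇒rowLen-antitone (_ ∷ y ∷ μ) (_ ∷ μ↓)  (suc a) = linked⇒rowLen-antitone (y ∷ μ) μ↓ a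

rowLen-antitone : ∀ μ → IsPartition μ → Antitone (rowLen μ)
rowLen-antitone μ pμ = linked⇒rowLen-antitone μ (proj₁ pμ)

fromRowLengths : (ℕ → ℕ) → ℕ → List ℕ
fromRowLengths L zero    = []
fromRowLengths L (suc n) with L 0
... | zero  = []
... | suc x = suc x ∷ fromRowLengths (L ∘ suc) n

rowLen-fromRowLengths : ∀ L n → Antitone L → (∀ a → n ≤ a → L a ≡ 0) →
  ∀ a → rowLen (fromRowLengths L n) a ≡ L a
rowLen-fromRowLengths L zero    _  L-vanishes a = sym (L-vanishes a z≤n)
rowLen-fromRowLengths L (suc n) L↓ L-vanishes a with L 0 in L0≡
... | zero = sym (n≤0⇒n≡0 (subst (L a ≤_) L0≡ (antitone-≤ L↓ z≤n)))
rowLen-fromRowLengths L (suc n) L↓ L-vanishes zero    | suc x = sym L0≡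
rowLen-fromRowLengths L (suc n) L↓ L-vanishes (suc a) | suc x =
  rowLen-fromRowLengths (L ∘ suc) n (L↓ ∘ suc) (λ a n≤a → L-vanishes (suc a) (s≤s n≤a)) a

rowLen-antitone⇒linked : ∀ μ → Antitone (rowLen μ) → Linked _≥_ μ
rowLen-antitone⇒linked []          _  = []
rowLen-antitone⇒linked (_ ∷ [])    _  = [-]
rowLen-antitone⇒linked (_ ∷ y ∷ μ) μ↓ = μ↓ 0 ∷ rowLen-antitone⇒linked (y ∷ μ) (μ↓ ∘ suc)

fromRowLengths-positive : ∀ L n → All (1 ≤_) (fromRowLengths L n)
fromRowLengths-positive L zero = []
fromRowLengths-positive L (suc n) with L 0
... | zero  = []
... | suc x = s≤s z≤n ∷ fromRowLengths-positive (L ∘ suc) n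

fromRowLengths-isPartition : ∀ L n → Antitone L → (∀ a → n ≤ a → L a ≡ 0) → IsPartition (fromRowLengths L n)
fromRowLengths-isPartition L n L↓ L-vanishes =
  rowLen-antitone⇒linked _ rowLen↓ , fromRowLengths-positive L n
  where
  rowLen≡ : ∀ a → rowLen (fromRowLengths L n) a ≡ L a
  rowLen≡ = rowLen-fromRowLengths L n L↓ L-vanishes
  rowLen↓ : Antitone (rowLen (fromRowLengths L n))
  rowLen↓ a = subst₂ _≤_ (sym (rowLen≡ (suc a))) (sym (rowLen≡ a)) (L↓ a)

firstFrom : {Q : ℕ → Set} → (∀ c → Dec (Q c)) → ℕ → ℕ → ℕ
firstFrom Q? lo zero    = lo
firstFrom Q? lo (suc f) with Q? lo
... | yes _ = lo
... | no  _ = firstFrom Q? (suc lo) f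

module _ {Q : ℕ → Set} (Q? : ∀ c → Dec (Q c)) where

  firstFrom-≥ : ∀ lo f → lo ≤ firstFrom Q? lo f
  firstFrom-≥ lo zero    = ≤-refl
  firstFrom-≥ lo (suc f) with Q? lo
  ... | yes _ = ≤-refl
  ... | no  _ = ≤-trans (n≤1+n lo) (firstFrom-≥ (suc lo) f)

  firstFrom-≤ : ∀ lo f → firstFrom Q? lo f ≤ lo + f
  firstFrom-≤ lo zero    = ≤-reflexive (sym (+-identityʳ lo))
  firstFrom-≤ lo (suc f) with Q? lo
  ... | yes _ = m≤m+n lo (suc f)
  ... | no  _ = ≤-trans (firstFrom-≤ (suc lo) f) (≤-reflexive (sym (+-suc lo f)))

  firstFrom-minimal : ∀ lo f {c} → lo ≤ c → c < firstFrom Q? lo f → ¬ Q c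
  firstFrom-minimal lo zero    lo≤c c<lo = ⊥-elim (<-irrefl refl (≤-trans (s≤s lo≤c) c<lo))
  firstFrom-minimal lo (suc f) lo≤c c<  with Q? lo
  ... | yes _ = ⊥-elim (<-irrefl refl (≤-trans (s≤s lo≤c) c<))
  ... | no ¬Qlo with m≤n⇒m<n∨m≡n lo≤c
  ...   | inj₂ refl  = ¬Qlo
  ...   | inj₁ lo<c  = firstFrom-minimal (suc lo) f lo<c c<

  firstFrom-found : ∀ lo f → firstFrom Q? lo f < lo + f → Q (firstFrom Q? lo f)
  firstFrom-found lo zero    first< = ⊥-elim (<-irrefl (sym (+-identityʳ lo)) first<)
  firstFrom-found lo (suc f) first< with Q? lo
  ... | yes Qlo = Qlo
  ... | no  _   = firstFrom-found (suc lo) f (≤-trans first< (≤-reflexive (+-suc lo f)))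

skew-intro : ∀ ν μ {a c} → rowLen μ a ≤ c → c < rowLen ν a → InSkew ν μ (a , c)
skew-intro _ _ μ≤c c<ν = c<ν , ≤⇒≯ μ≤c

-- κ lies between μ and ν, and ν/κ consists exactly of the Q-boxes of ν/μ.
module Threshold
  (ν μ : List ℕ) (pν : IsPartition ν) (pμ : IsPartition μ) (μ⊆ν : μ ⊆ₚ ν)
  (Q : Box → Set) (Q? : ∀ b → Dec (Q b))
  (Q-right : ∀ a c → InSkew ν μ (a , c) → InSkew ν μ (a , suc c) → Q (a , c) → Q (a , suc c))
  (Q-down : ∀ a c → InSkew ν μ (a , c) → InSkew ν μ (suc a , c) → Q (a , c) → Q (suc a , c))
  where

  private
    width : ℕ → ℕ
    width a = rowLen ν a ∸ rowLen μ a

    μ+width : ∀ a → rowLen μ a + width a ≡ rowLen ν a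
    μ+width a = m+[n∸m]≡n (μ⊆ν a)

  cut : ℕ → ℕ
  cut a = firstFrom (λ c → Q? (a , c)) (rowLen μ a) (width a)

  cut-≥ : ∀ a → rowLen μ a ≤ cut a
  cut-≥ a = firstFrom-≥ (λ c → Q? (a , c)) (rowLen μ a) (width a)

  cut-≤ : ∀ a → cut a ≤ rowLen ν a
  cut-≤ a = subst (cut a ≤_) (μ+width a) (firstFrom-≤ (λ c → Q? (a , c)) (rowLen μ a) (width a))

  ¬Q-before-cut : ∀ {a c} → rowLen μ a ≤ c → c < cut a → ¬ Q (a , c)
  ¬Q-before-cut {a} = firstFrom-minimal (λ c → Q? (a , c)) (rowLen μ a) (width a)

  Q-rightward : ∀ {a c c′} → InSkew ν μ (a , c) → c ≤ c′ → c′ < rowLen ν a → Q (a , c) → Q (a , c′)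
  Q-rightward {a} {c} {c′} c∈ c≤c′ c′<ν Qc with m≤n⇒m<n∨m≡n c≤c′
  ... | inj₂ refl = Qc
  Q-rightward {a} {c} {suc c″} c∈ _ c′<ν Qc | inj₁ (s≤s c≤c″) =
    Q-right a c″ (skew-intro ν μ μ≤c″ (<-trans (n<1+n c″) c′<ν)) (skew-intro ν μ (m≤n⇒m≤1+n μ≤c″) c′<ν)
      (Q-rightward c∈ c≤c″ (<-trans (n<1+n c″) c′<ν) Qc)
    where μ≤c″ = ≤-trans (≮⇒≥ (proj₂ c∈)) c≤c″

  Q-from-cut : ∀ {a c} → cut a ≤ c → c < rowLen ν a → Q (a , c)
  Q-from-cut {a} cut≤c c<ν =
    Q-rightward (skew-intro ν μ (cut-≥ a) cut<ν) cut≤c c<ν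
      (firstFrom-found (λ c → Q? (a , c)) (rowLen μ a) (width a) (subst (cut a <_) (sym (μ+width a)) cut<ν))
    where cut<ν = ≤-<-trans cut≤c c<ν

  cut-antitone : Antitone cut
  cut-antitone a = ≮⇒≥ cut-grows
    where
    cut-grows : cut a < cut (suc a) → ⊥
    cut-grows c<cut′ with cut a <? rowLen ν a
    ... | no  c≮ν = ≤⇒≯ (≤-trans (cut-≤ (suc a)) (≤-trans (rowLen-antitone ν pν a) (≮⇒≥ c≮ν))) c<cut′
    ... | yes c<ν = ¬Q-before-cut μ′≤c c<cut′
                      (Q-down a _ (skew-intro ν μ (cut-≥ a) c<ν) (skew-intro ν μ μ′≤c (<-≤-trans c<cut′ (cut-≤ (suc a))))
                        (Q-from-cut ≤-refl c<ν))
      where μ′≤c = ≤-trans (rowLen-antitone μ pμ a) (cut-≥ a)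

  cut-vanishes : ∀ a → length ν ≤ a → cut a ≡ 0
  cut-vanishes a ν≤a = n≤0⇒n≡0 (subst (cut a ≤_) (rowLen-beyond ν ν≤a) (cut-≤ a))

  κ : List ℕ
  κ = fromRowLengths cut (length ν)

  rowLen-κ : ∀ a → rowLen κ a ≡ cut a
  rowLen-κ = rowLen-fromRowLengths cut (length ν) cut-antitone cut-vanishes

  κ-isPartition : IsPartition κ
  κ-isPartition = fromRowLengths-isPartition cut (length ν) cut-antitone cut-vanishes

  μ⊆κ : μ ⊆ₚ κ
  μ⊆κ a = subst (rowLen μ a ≤_) (sym (rowLen-κ a)) (cut-≥ a)

  κ⊆ν : κ ⊆ₚ ν
  κ⊆ν a = subst (_≤ rowLen ν a) (sym (rowLen-κ a)) (cut-≤ a)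

  outer⊆ : ∀ b → InSkew ν κ b → InSkew ν μ b
  outer⊆ b (b<ν , b≮κ) = b<ν , λ b<μ → b≮κ (<-≤-trans b<μ (μ⊆κ (row b)))

  inner⊆ : ∀ b → InSkew κ μ b → InSkew ν μ b
  inner⊆ b (b<κ , b≮μ) = <-≤-trans b<κ (κ⊆ν (row b)) , b≮μ

  outer⇒Q : ∀ b → InSkew ν κ b → Q b
  outer⇒Q b (b<ν , b≮κ) = Q-from-cut (subst (_≤ col b) (rowLen-κ (row b)) (≮⇒≥ b≮κ)) b<ν

  inner⇒¬Q : ∀ b → InSkew κ μ b → ¬ Q b
  inner⇒¬Q b (b<κ , b≮μ) = ¬Q-before-cut (≮⇒≥ b≮μ) (subst (col b <_) (rowLen-κ (row b)) b<κ)

  Q⇒outer : ∀ b → InSkew ν μ b → Q b → InSkew ν κ b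
  Q⇒outer b b∈ Qb = proj₁ b∈ , λ b<κ → inner⇒¬Q b (b<κ , proj₂ b∈) Qb

  ¬Q⇒inner : ∀ b → InSkew ν μ b → ¬ Q b → InSkew κ μ b
  ¬Q⇒inner b b∈ ¬Qb = ≰⇒> (λ κ≤b → ¬Qb (outer⇒Q b (proj₁ b∈ , ≤⇒≯ κ≤b))) , proj₂ b∈

-- the order in which rl fills the boxes of a skew shape
infix 4 _≺_
_≺_ : Box → Box → Set
(a , c) ≺ (a′ , c′) = a < a′ ⊎ (a ≡ a′ × c′ < c)

at-map-downFrom : ∀ (h : ℕ → Box) {n u} → u < n → at (map h (downFrom n)) u ≡ h (n ∸ suc u)
at-map-downFrom h {suc n} {zero}  _         = refl
at-map-downFrom h {suc n} {suc u} (s≤s u<n) = at-map-downFrom h u<n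

column-of-rightIndex : ∀ b c a → b ≤ c → c < a → b + (a ∸ b ∸ suc (a ∸ suc c)) ≡ c
column-of-rightIndex zero    c       (suc a) _         (s≤s c≤a) = m∸[m∸n]≡n c≤a
column-of-rightIndex (suc b) (suc c) (suc a) (s≤s b≤c) (s≤s c<a) = cong suc (column-of-rightIndex b c a b≤c c<a)

rightIndex-of-column : ∀ b L u → u < L → b + L ∸ suc (b + (L ∸ suc u)) ≡ u
rightIndex-of-column zero    (suc L) u (s≤s u≤L) = m∸[m∸n]≡n u≤L
rightIndex-of-column (suc b) L       u u<L       = rightIndex-of-column b L u u<L

module RevLex (α β : List ℕ) (β⊆α : β ⊆ₚ α) (β-pos : All (1 ≤_) β) where

  private
    A B W : ℕ → ℕ
    A = rowLen α
    B = rowLen β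
    W i = A i ∸ B i

  rowBlock : ℕ → List Box
  rowBlock i = rowBoxesRL (A i) (B i) i

  length-rowBlock : ∀ i → length (rowBlock i) ≡ W i
  length-rowBlock i = trans (length-map _ (downFrom (W i))) (length-applyDownFrom id (W i))

  offset : ℕ → ℕ
  offset = blockStart rowBlock

  offset-suc : ∀ a → offset (suc a) ≡ offset a + W a
  offset-suc a = trans (sumTo-suc (length ∘ rowBlock) a) (cong (offset a +_) (length-rowBlock a))

  -- the entry of box (a , c) in rl(α/β): the rows above come first, then row a from its right end
  label : Box → ℕ
  label (a , c) = suc (offset a + (A a ∸ suc c))

  rlList≡ : rlList α β ≡ concat (applyUpTo rowBlock (length α))
  rlList≡ = cong concat (map-applyUpTo id rowBlock (length α))

  boxCount≡skewSize : offset (length α) ≡ skewSize α β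
  boxCount≡skewSize = begin
    offset N                              ≡⟨ sumTo-cong length-rowBlock N ⟩
    sumTo W N                             ≡⟨ sym (m+n∸m≡n (sumTo B N) _) ⟩
    sumTo B N + sumTo W N ∸ sumTo B N     ≡⟨ cong (_∸ sumTo B N) (sym (sumTo-+ B W N)) ⟩
    sumTo (λ i → B i + W i) N ∸ sumTo B N ≡⟨ cong (_∸ sumTo B N) (sumTo-cong (λ i → m+[n∸m]≡n (β⊆α i)) N) ⟩
    sumTo A N ∸ sumTo B N                 ≡⟨ cong₂ _∸_ (sumTo-rowLen α ≤-refl) (sumTo-rowLen β (⊆ₚ⇒length≤ {ν = α} β-pos β⊆α)) ⟩
    size α ∸ size β                       ∎
    where
    open ≡-Reasoning
    N : ℕ
    N = length α

  length-concat-rowBlocks : length (concat (applyUpTo rowBlock (length α))) ≡ skewSize α β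
  length-concat-rowBlocks = trans (length-concat-applyUpTo rowBlock (length α)) boxCount≡skewSize

  row<length : ∀ {a c} → InSkew α β (a , c) → a < length α
  row<length {a} {c} (c<A , _) = ≰⇒> λ len≤a → n≮0 (subst (c <_) (rowLen-beyond α len≤a) c<A)

  rightIndex<W : ∀ {a c} → InSkew α β (a , c) → A a ∸ suc c < W a
  rightIndex<W {a} {c} (c<A , c≮B) = ∸-monoʳ-< {A a} {suc c} {B a} (s≤s (≮⇒≥ c≮B)) c<A

  rl-label : ∀ b → InSkew α β b → rl α β (label b) ≡ b
  rl-label (a , c) b∈@(c<A , c≮B) = begin
    at (rlList α β) (offset a + u)                              ≡⟨ cong (λ L → at L (offset a + u)) rlList≡ ⟩
    at (concat (applyUpTo rowBlock (length α))) (offset a + u)  ≡⟨ at-concat-applyUpTo rowBlock (row<length b∈) u<len ⟩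
    at (rowBlock a) u                                           ≡⟨ at-map-downFrom _ (rightIndex<W b∈) ⟩
    (a , B a + (W a ∸ suc u))                                   ≡⟨ cong (a ,_) (column-of-rightIndex (B a) c (A a) (≮⇒≥ c≮B) c<A) ⟩
    (a , c)                                                     ∎
    where
    open ≡-Reasoning
    u : ℕ
    u = A a ∸ suc c
    u<len : u < length (rowBlock a)
    u<len = subst (u <_) (sym (length-rowBlock a)) (rightIndex<W b∈)

  label-injective : ∀ p q → InSkew α β p → InSkew α β q → label p ≡ label q → p ≡ q
  label-injective p q p∈ q∈ eq = trans (sym (rl-label p p∈)) (trans (cong (rl α β) eq) (rl-label q q∈))

  label≤offset-suc : ∀ {a c} → InSkew α β (a , c) → label (a , c) ≤ offset (suc a)
  label≤offset-suc {a} {c} b∈ = begin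
    suc (offset a + (A a ∸ suc c)) ≡⟨ sym (+-suc (offset a) _) ⟩
    offset a + suc (A a ∸ suc c)   ≤⟨ +-monoʳ-≤ (offset a) (rightIndex<W b∈) ⟩
    offset a + W a                 ≡⟨ sym (offset-suc a) ⟩
    offset (suc a)                 ∎
    where open ≤-Reasoning

  label-inRange : ∀ b → InSkew α β b → InRange (skewSize α β) (label b)
  label-inRange (a , c) b∈ =
    s≤s z≤n ,
    ≤-trans (label≤offset-suc b∈)
      (≤-trans (sumTo-monoʳ-≤ (length ∘ rowBlock) (row<length b∈)) (≤-reflexive boxCount≡skewSize))

  label-mono : ∀ p q → InSkew α β p → p ≺ q → label p < label q
  label-mono (a , c) (a′ , c′) p∈ (inj₁ a<a′) =
    s≤s (≤-trans (label≤offset-suc p∈) (≤-trans (sumTo-monoʳ-≤ (length ∘ rowBlock) a<a′) (m≤m+n (offset a′) _)))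
  label-mono (a , c) (.a , c′) (c<A , _) (inj₂ (refl , c′<c)) =
    s≤s (+-monoʳ-< (offset a) (∸-monoʳ-< (s≤s c′<c) c<A))

  label-<⇒≺ : ∀ p q → InSkew α β p → InSkew α β q → label p < label q → p ≺ q
  label-<⇒≺ (a , c) (a′ , c′) p∈ q∈ lt with <-cmp a a′
  ... | tri< a<a′ _ _ = inj₁ a<a′
  ... | tri> _ _ a>a′ = ⊥-elim (<-asym lt (label-mono _ _ q∈ (inj₁ a>a′)))
  label-<⇒≺ (a , c) (.a , c′) p∈ q∈ lt | tri≈ _ refl _ with <-cmp c c′
  ... | tri< c<c′ _ _ = ⊥-elim (<-asym lt (label-mono _ _ q∈ (inj₂ (refl , c<c′))))
  ... | tri≈ _ refl _ = ⊥-elim (<-irrefl refl lt)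
  ... | tri> _ _ c>c′ = inj₂ (refl , c>c′)

  label-left : ∀ a c → suc c < A a → label (a , c) ≡ suc (label (a , suc c))
  label-left a c sc<A = cong suc (trans (cong (offset a +_) (+-∸-assoc 1 sc<A)) (+-suc (offset a) _))

  label-suc⇒left : ∀ a c c′ → InSkew α β (a , c) → InSkew α β (a , c′) →
    suc (label (a , c)) ≡ label (a , c′) → c ≡ suc c′
  label-suc⇒left a c c′ (c<A , _) (c′<A , _) eq = suc-injective (sym (+-cancelˡ-≡ u _ _ shifted))
    where
    u : ℕ
    u = A a ∸ suc c
    suc-u : suc u ≡ A a ∸ suc c′
    suc-u = +-cancelˡ-≡ (offset a) _ _ (trans (+-suc (offset a) u) (suc-injective eq))
    shifted : u + suc (suc c′) ≡ u + suc c
    shifted = trans (+-suc u (suc c′)) (trans (cong (_+ suc c′) suc-u) (trans (m∸n+n≡m c′<A) (sym (m∸n+n≡m c<A))))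

  rl-inSkew×label-rl : ∀ k → InRange (skewSize α β) k → InSkew α β (rl α β k) × label (rl α β k) ≡ k
  rl-inSkew×label-rl (suc t) (_ , t<size)
    with concat-applyUpTo-index rowBlock (length α) (subst (t <_) (sym length-concat-rowBlocks) t<size)
  ... | i , u , i<N , u<len , t≡ = subst (λ b → InSkew α β b × label b ≡ suc t) (sym rl≡) (c∈ , label≡)
    where
    u<W : u < W i
    u<W = subst (u <_) (length-rowBlock i) u<len
    c : ℕ
    c = B i + (W i ∸ suc u)
    B<A : B i < A i
    B<A = m∸n≢0⇒n<m (λ W≡0 → n≮0 (subst (u <_) W≡0 u<W))
    A≡ : A i ≡ B i + W i
    A≡ = sym (m+[n∸m]≡n (<⇒≤ B<A))
    c∈ : InSkew α β (i , c)
    c∈ = subst (c <_) (sym A≡) (+-monoʳ-< (B i) (∸-monoʳ-< {W i} {suc u} {0} (s≤s z≤n) u<W)) ,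
         m+n≮m (B i) _
    rl≡ : rl α β (suc t) ≡ (i , c)
    rl≡ = begin
      at (rlList α β) t                                          ≡⟨ cong (λ L → at L t) rlList≡ ⟩
      at (concat (applyUpTo rowBlock (length α))) t              ≡⟨ cong (at (concat (applyUpTo rowBlock (length α)))) t≡ ⟩
      at (concat (applyUpTo rowBlock (length α))) (offset i + u) ≡⟨ at-concat-applyUpTo rowBlock i<N u<len ⟩
      at (rowBlock i) u                                          ≡⟨ at-map-downFrom _ u<W ⟩
      (i , c)                                                    ∎
      where open ≡-Reasoning
    label≡ : label (i , c) ≡ suc t
    label≡ = cong suc (trans (cong (offset i +_) (trans (cong (_∸ suc c) A≡) (rightIndex-of-column (B i) (W i) u u<W)))
                             (sym t≡))

  rl-inSkew : ∀ k → InRange (skewSize α β) k → InSkew α β (rl α β k)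
  rl-inSkew k k∈ = proj₁ (rl-inSkew×label-rl k k∈)

  label-rl : ∀ k → InRange (skewSize α β) k → label (rl α β k) ≡ k
  label-rl k k∈ = proj₂ (rl-inSkew×label-rl k k∈)

_≟Box_ : (b b′ : Box) → Dec (b ≡ b′)
_≟Box_ = ≡-dec _≟_ _≟_

-- 0 if no label in 1..n is sent to b
preimage : Tab → ℕ → Box → ℕ
preimage T n b with any? (λ (i : Fin n) → T (suc (toℕ i)) ≟Box b)
... | yes (i , _) = suc (toℕ i)
... | no  _       = 0

preimage-spec : ∀ T n b → ∃[ k ] (InRange n k × T k ≡ b) →
  InRange n (preimage T n b) × T (preimage T n b) ≡ b
preimage-spec T n b (suc k , (_ , k<n) , Tk≡b) with any? (λ (i : Fin n) → T (suc (toℕ i)) ≟Box b)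
... | yes (i , Ti≡b) = (s≤s z≤n , toℕ<n i) , Ti≡b
... | no  none       = ⊥-elim (none (fromℕ< k<n , subst (λ j → T (suc j) ≡ b) (sym (toℕ-fromℕ< k<n)) Tk≡b))

injectiveOn⇒≤ : ∀ {m n} (f : ℕ → ℕ) → (∀ k → InRange m k → InRange n (f k)) →
  (∀ k l → InRange m k → InRange m l → f k ≡ f l → k ≡ l) → m ≤ n
injectiveOn⇒≤ {m} {n} f f∈ f-inj = injective⇒≤ F-injective
  where
  index : Fin m → ℕ
  index i = suc (toℕ i)
  index∈ : ∀ i → InRange m (index i)
  index∈ i = s≤s z≤n , toℕ<n i
  image< : ∀ i → f (index i) ∸ 1 < n
  image< i with f∈ (index i) (index∈ i)
  ... | 1≤fi , fi≤n = subst (_≤ n) (trans (sym (m∸n+n≡m 1≤fi)) (+-comm _ 1)) fi≤n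
  F : Fin m → Fin n
  F i = fromℕ< (image< i)
  F-injective : ∀ {i j} → F i ≡ F j → i ≡ j
  F-injective {i} {j} Fi≡Fj = toℕ-injective (suc-injective (f-inj _ _ (index∈ i) (index∈ j) fi≡fj))
    where
    pred-eq : f (index i) ∸ 1 ≡ f (index j) ∸ 1
    pred-eq = trans (sym (toℕ-fromℕ< (image< i))) (trans (cong toℕ Fi≡Fj) (toℕ-fromℕ< (image< j)))
    fi≡fj : f (index i) ≡ f (index j)
    fi≡fj = trans (sym (m∸n+n≡m (proj₁ (f∈ _ (index∈ i)))))
                  (trans (cong (_+ 1) pred-eq) (m∸n+n≡m (proj₁ (f∈ _ (index∈ j)))))

module RWTableau (γ δ α β : List ℕ) (T : Tab) (rw : RW γ δ α β T) where

  private
    n : ℕ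
    n = skewSize α β
    toStd : ∀ {k} → InRange n k → InRange (skewSize γ δ) k
    toStd {k} = subst (λ m → InRange m k) (sym (proj₁ (proj₂ rw)))
    std : StandardSkew γ δ T
    std = proj₁ rw

  T-inSkew : ∀ k → InRange n k → InSkew γ δ (T k)
  T-inSkew k k∈ = proj₁ std k (toStd k∈)

  T-injective : ∀ k l → InRange n k → InRange n l → T k ≡ T l → k ≡ l
  T-injective k l k∈ l∈ = proj₁ (proj₂ std) k l (toStd k∈) (toStd l∈)

  T-surjective : ∀ b → InSkew γ δ b → ∃[ k ] (InRange n k × T k ≡ b)
  T-surjective b b∈ with proj₁ (proj₂ (proj₂ std)) b b∈
  ... | k , k∈ , Tk≡b = k , subst (λ m → InRange m k) (proj₁ (proj₂ rw)) k∈ , Tk≡b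

  T-rowOrder : ∀ k l → InRange n k → InRange n l → row (T k) ≡ row (T l) → col (T k) < col (T l) → k < l
  T-rowOrder k l k∈ l∈ = proj₁ (proj₂ (proj₂ (proj₂ std))) k l (toStd k∈) (toStd l∈)

  T-colOrder : ∀ k l → InRange n k → InRange n l → col (T k) ≡ col (T l) → row (T k) < row (T l) → k < l
  T-colOrder k l k∈ l∈ = proj₂ (proj₂ (proj₂ (proj₂ std))) k l (toStd k∈) (toStd l∈)

  horizontal : ∀ i → InRange n i → InRange n (suc i) → row (rl α β i) ≡ row (rl α β (suc i)) →
    col (T i) < col (T (suc i)) × row (T (suc i)) ≤ row (T i)
  horizontal = proj₁ (proj₂ (proj₂ rw))

  vertical : ∀ i j → InRange n i → InRange n j →
    row (rl α β j) ≡ suc (row (rl α β i)) → col (rl α β j) ≡ col (rl α β i) →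
    row (T i) < row (T j) × col (T j) ≤ col (T i)
  vertical = proj₂ (proj₂ (proj₂ rw))

module Restriction
  (γ δ α β : List ℕ) (T : Tab) (rw : RW γ δ α β T) (β⊆α : β ⊆ₚ α) (β-pos : All (1 ≤_) β)
  (γ′ δ′ α′ β′ : List ℕ) (β′⊆α′ : β′ ⊆ₚ α′) (β′-pos : All (1 ≤_) β′)
  (δ′⊆γ′ : δ′ ⊆ₚ γ′) (δ′-pos : All (1 ≤_) δ′)
  (α′β′⊆αβ : ∀ b → InSkew α′ β′ b → InSkew α β b)
  (γ′δ′⊆γδ : ∀ b → InSkew γ′ δ′ b → InSkew γ δ b)
  (preserves : ∀ b → InSkew α β b → InSkew α′ β′ b → InSkew γ′ δ′ (T (RevLex.label α β β⊆α β-pos b)))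
  (reflects : ∀ b → InSkew α β b → InSkew γ′ δ′ (T (RevLex.label α β β⊆α β-pos b)) → InSkew α′ β′ b)
  where

  open RWTableau γ δ α β T rw
  private
    module L  = RevLex α β β⊆α β-pos
    module L′ = RevLex α′ β′ β′⊆α′ β′-pos
    module Lγ = RevLex γ′ δ′ δ′⊆γ′ δ′-pos
    n m : ℕ
    n = skewSize α β
    m = skewSize α′ β′

  slot : ℕ → ℕ
  slot j = L.label (rl α′ β′ j)

  restrict : Tab
  restrict j = T (slot j)

  private
    rl′∈ : ∀ j → InRange m j → InSkew α β (rl α′ β′ j)
    rl′∈ j j∈ = α′β′⊆αβ _ (L′.rl-inSkew j j∈)

    slot∈ : ∀ j → InRange m j → InRange n (slot j)
    slot∈ j j∈ = L.label-inRange _ (rl′∈ j j∈)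

  rl-slot : ∀ j → InRange m j → rl α β (slot j) ≡ rl α′ β′ j
  rl-slot j j∈ = L.rl-label _ (rl′∈ j j∈)

  restrict-inSkew : ∀ j → InRange m j → InSkew γ′ δ′ (restrict j)
  restrict-inSkew j j∈ = preserves _ (rl′∈ j j∈) (L′.rl-inSkew j j∈)

  restrict-injective : ∀ j l → InRange m j → InRange m l → restrict j ≡ restrict l → j ≡ l
  restrict-injective j l j∈ l∈ eq = begin
    j                           ≡⟨ sym (L′.label-rl j j∈) ⟩
    L′.label (rl α′ β′ j)       ≡⟨ cong L′.label (sym (rl-slot j j∈)) ⟩
    L′.label (rl α β (slot j))  ≡⟨ cong (L′.label ∘ rl α β) (T-injective _ _ (slot∈ j j∈) (slot∈ l l∈) eq) ⟩
    L′.label (rl α β (slot l))  ≡⟨ cong L′.label (rl-slot l l∈) ⟩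
    L′.label (rl α′ β′ l)       ≡⟨ L′.label-rl l l∈ ⟩
    l                           ∎
    where open ≡-Reasoning

  slot-reflects-< : ∀ j l → InRange m j → InRange m l → slot j < slot l → j < l
  slot-reflects-< j l j∈ l∈ lt with <-cmp j l
  ... | tri< j<l _ _ = j<l
  ... | tri≈ _ refl _ = ⊥-elim (<-irrefl refl lt)
  ... | tri> _ _ j>l = ⊥-elim (<-asym lt (L.label-mono _ _ (rl′∈ l l∈)
                          (L′.label-<⇒≺ _ _ (L′.rl-inSkew l l∈) (L′.rl-inSkew j j∈)
                            (subst₂ _<_ (sym (L′.label-rl l l∈)) (sym (L′.label-rl j j∈)) j>l))))

  unrestrict : Box → ℕ
  unrestrict b = L′.label (rl α β (preimage T n b))

  unrestrict-spec : ∀ b → InSkew γ′ δ′ b → InRange m (unrestrict b) × restrict (unrestrict b) ≡ b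
  unrestrict-spec b b∈ = L′.label-inRange p p∈′ , restrict-unrestrict
    where
    k : ℕ
    k = preimage T n b
    k-spec : InRange n k × T k ≡ b
    k-spec = preimage-spec T n b (T-surjective b (γ′δ′⊆γδ b b∈))
    p : Box
    p = rl α β k
    p∈ : InSkew α β p
    p∈ = L.rl-inSkew k (proj₁ k-spec)
    T-label-p : T (L.label p) ≡ b
    T-label-p = trans (cong T (L.label-rl k (proj₁ k-spec))) (proj₂ k-spec)
    p∈′ : InSkew α′ β′ p
    p∈′ = reflects p p∈ (subst (InSkew γ′ δ′) (sym T-label-p) b∈)
    restrict-unrestrict : T (L.label (rl α′ β′ (L′.label p))) ≡ b
    restrict-unrestrict = trans (cong (T ∘ L.label) (L′.rl-label p p∈′)) T-label-p

  sizes : skewSize γ′ δ′ ≡ m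
  sizes = ≤-antisym
    (injectiveOn⇒≤ (unrestrict ∘ rl γ′ δ′) (λ i i∈ → proj₁ (unrestrict-spec _ (Lγ.rl-inSkew i i∈)))
       λ i l i∈ l∈ eq → begin
         i                                             ≡⟨ sym (Lγ.label-rl i i∈) ⟩
         Lγ.label (rl γ′ δ′ i)                         ≡⟨ cong Lγ.label (sym (proj₂ (unrestrict-spec _ (Lγ.rl-inSkew i i∈)))) ⟩
         Lγ.label (restrict (unrestrict (rl γ′ δ′ i))) ≡⟨ cong (Lγ.label ∘ restrict) eq ⟩
         Lγ.label (restrict (unrestrict (rl γ′ δ′ l))) ≡⟨ cong Lγ.label (proj₂ (unrestrict-spec _ (Lγ.rl-inSkew l l∈))) ⟩
         Lγ.label (rl γ′ δ′ l)                         ≡⟨ Lγ.label-rl l l∈ ⟩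
         l                                             ∎)
    (injectiveOn⇒≤ (Lγ.label ∘ restrict) (λ j j∈ → Lγ.label-inRange _ (restrict-inSkew j j∈))
       λ j l j∈ l∈ eq → restrict-injective j l j∈ l∈
         (Lγ.label-injective _ _ (restrict-inSkew j j∈) (restrict-inSkew l l∈) eq))
    where open ≡-Reasoning

  label-consecutive : ∀ b₁ b₂ → InSkew α′ β′ b₁ → InSkew α′ β′ b₂ → row b₁ ≡ row b₂ →
    suc (L′.label b₁) ≡ L′.label b₂ → L.label b₂ ≡ suc (L.label b₁)
  label-consecutive (a , c) (.a , c₂) b₁∈ b₂∈ refl eq with L′.label-suc⇒left a c c₂ b₁∈ b₂∈ eq
  ... | refl = L.label-left a c₂ (proj₁ (α′β′⊆αβ _ b₁∈))

  slot-suc : ∀ i → InRange m i → InRange m (suc i) → row (rl α′ β′ i) ≡ row (rl α′ β′ (suc i)) →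
    slot (suc i) ≡ suc (slot i)
  slot-suc i i∈ si∈ same-row = label-consecutive _ _ (L′.rl-inSkew i i∈) (L′.rl-inSkew (suc i) si∈) same-row
    (trans (cong suc (L′.label-rl i i∈)) (sym (L′.label-rl (suc i) si∈)))

  restrict-horizontal : ∀ i → InRange m i → InRange m (suc i) → row (rl α′ β′ i) ≡ row (rl α′ β′ (suc i)) →
    col (restrict i) < col (restrict (suc i)) × row (restrict (suc i)) ≤ row (restrict i)
  restrict-horizontal i i∈ si∈ same-row =
    subst (λ k → col (T (slot i)) < col (T k) × row (T k) ≤ row (T (slot i))) (sym step)
      (horizontal (slot i) (slot∈ i i∈) (subst (InRange n) step (slot∈ (suc i) si∈)) rows)
    where
    step : slot (suc i) ≡ suc (slot i)
    step = slot-suc i i∈ si∈ same-row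
    rows : row (rl α β (slot i)) ≡ row (rl α β (suc (slot i)))
    rows = trans (cong row (rl-slot i i∈))
                 (trans same-row (cong row (trans (sym (rl-slot (suc i) si∈)) (cong (rl α β) step))))

  restrict-vertical : ∀ i j → InRange m i → InRange m j →
    row (rl α′ β′ j) ≡ suc (row (rl α′ β′ i)) → col (rl α′ β′ j) ≡ col (rl α′ β′ i) →
    row (restrict i) < row (restrict j) × col (restrict j) ≤ col (restrict i)
  restrict-vertical i j i∈ j∈ rows cols = vertical (slot i) (slot j) (slot∈ i i∈) (slot∈ j j∈)
    (trans (cong row (rl-slot j j∈)) (trans rows (cong (suc ∘ row) (sym (rl-slot i i∈)))))
    (trans (cong col (rl-slot j j∈)) (trans cols (cong col (sym (rl-slot i i∈)))))

  restrict-RW : RW γ′ δ′ α′ β′ restrict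
  restrict-RW =
    ( (λ k k∈ → restrict-inSkew k (toM k∈))
    , (λ k l k∈ l∈ → restrict-injective k l (toM k∈) (toM l∈))
    , (λ b b∈ → unrestrict b , fromM (proj₁ (unrestrict-spec b b∈)) , proj₂ (unrestrict-spec b b∈))
    , (λ k l k∈ l∈ rows cols → slot-reflects-< k l (toM k∈) (toM l∈)
         (T-rowOrder _ _ (slot∈ k (toM k∈)) (slot∈ l (toM l∈)) rows cols))
    , (λ k l k∈ l∈ cols rows → slot-reflects-< k l (toM k∈) (toM l∈)
         (T-colOrder _ _ (slot∈ k (toM k∈)) (slot∈ l (toM l∈)) cols rows)) )
    , sizes , restrict-horizontal , restrict-vertical
    where
    toM : ∀ {k} → InRange (skewSize γ′ δ′) k → InRange m k
    toM {k} = subst (λ s → InRange s k) sizes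
    fromM : ∀ {k} → InRange m k → InRange (skewSize γ′ δ′) k
    fromM {k} = subst (λ s → InRange s k) (sym sizes)

-- With contents c(b) = col b − row b: if c(q) < c(p), the row rule for q with T-row ρ + 1
-- gives the row rule for p with T-row ρ.
rowRule-transfer : ∀ r rp rq cp cq ρ → suc (cq + rp) ≤ cp + rq → r + rq ≤ suc ρ + 1 + cq → r + rp ≤ ρ + 1 + cp
rowRule-transfer r rp rq cp cq ρ content< rule = +-cancelʳ-≤ (suc cq) _ _ (begin
  r + rp + suc cq        ≡⟨ solve 3 (λ r rp cq → r :+ rp :+ (con 1 :+ cq) := r :+ (con 1 :+ (cq :+ rp))) refl r rp cq ⟩
  r + suc (cq + rp)      ≤⟨ +-monoʳ-≤ r content< ⟩
  r + (cp + rq)          ≡⟨ solve 3 (λ r cp rq → r :+ (cp :+ rq) := r :+ rq :+ cp) refl r cp rq ⟩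
  r + rq + cp            ≤⟨ +-monoˡ-≤ cp rule ⟩
  suc ρ + 1 + cq + cp    ≡⟨ solve 3 (λ ρ cq cp → con 1 :+ ρ :+ con 1 :+ cq :+ cp := ρ :+ con 1 :+ cp :+ (con 1 :+ cq)) refl ρ cq cp ⟩
  ρ + 1 + cp + suc cq    ∎)
  where
  open ≤-Reasoning
  open +-*-Solver

module Factorisation
  (r : ℕ) (α₁ α₂ β₁ β₂ : List ℕ) (T : Tab)
  (pα₁ : IsPartition α₁) (pα₂ : IsPartition α₂) (pβ₁ : IsPartition β₁) (pβ₂ : IsPartition β₂)
  (α₁⊆β₁ : α₁ ⊆ₚ β₁) (β₂⊆α₂ : β₂ ⊆ₚ α₂) (rw : RW β₁ α₁ α₂ β₂ T)
  where

  open RWTableau β₁ α₁ α₂ β₂ T rw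
  private
    module L = RevLex α₂ β₂ β₂⊆α₂ (proj₂ pβ₂)
    n : ℕ
    n = skewSize α₂ β₂
  open L using (label)

  image : Box → Box
  image b = T (label b)

  RowRuleAt : Box → Set
  RowRuleAt b = r + row b ≤ row (image b) + 1 + col b

  image-right : ∀ a c → InSkew α₂ β₂ (a , c) → InSkew α₂ β₂ (a , suc c) →
    col (image (a , suc c)) < col (image (a , c)) × row (image (a , c)) ≤ row (image (a , suc c))
  image-right a c c∈ sc∈ =
    subst (λ k → col (T i) < col (T k) × row (T k) ≤ row (T i)) (sym step) (horizontal i i∈ si∈ rows)
    where
    i : ℕ
    i = label (a , suc c)
    step : label (a , c) ≡ suc i
    step = L.label-left a c (proj₁ sc∈)
    i∈ : InRange n i
    i∈ = L.label-inRange _ sc∈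
    si∈ : InRange n (suc i)
    si∈ = subst (InRange n) step (L.label-inRange _ c∈)
    rows : row (rl α₂ β₂ i) ≡ row (rl α₂ β₂ (suc i))
    rows = trans (cong row (L.rl-label _ sc∈)) (cong row (sym (trans (cong (rl α₂ β₂) (sym step)) (L.rl-label _ c∈))))

  image-down : ∀ a c → InSkew α₂ β₂ (a , c) → InSkew α₂ β₂ (suc a , c) →
    row (image (a , c)) < row (image (suc a , c)) × col (image (suc a , c)) ≤ col (image (a , c))
  image-down a c c∈ dc∈ = vertical (label (a , c)) (label (suc a , c)) (L.label-inRange _ c∈) (L.label-inRange _ dc∈)
    (trans (cong row (L.rl-label _ dc∈)) (cong (suc ∘ row) (sym (L.rl-label _ c∈))))
    (trans (cong col (L.rl-label _ dc∈)) (cong col (sym (L.rl-label _ c∈))))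

  image-rightward : ∀ a c c′ → c < c′ → InSkew α₂ β₂ (a , c) → InSkew α₂ β₂ (a , c′) →
    col (image (a , c′)) < col (image (a , c)) × row (image (a , c)) ≤ row (image (a , c′))
  image-rightward a c (suc c′) (s≤s c≤c′) c∈ sc′∈ with m≤n⇒m<n∨m≡n c≤c′
  ... | inj₂ refl = image-right a c c∈ sc′∈
  ... | inj₁ c<c′ =
    let c′∈ = <-trans (n<1+n c′) (proj₁ sc′∈) , λ c′<β → proj₂ c∈ (<-trans c<c′ c′<β)
        (col< , row≤) = image-rightward a c c′ c<c′ c∈ c′∈
        (col<′ , row≤′) = image-right a c′ c′∈ sc′∈
    in <-trans col<′ col< , ≤-trans row≤ row≤′

  image-downward : ∀ a a′ c → a < a′ → InSkew α₂ β₂ (a , c) → InSkew α₂ β₂ (a′ , c) →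
    row (image (a , c)) < row (image (a′ , c)) × col (image (a′ , c)) ≤ col (image (a , c))
  image-downward a (suc a′) c (s≤s a≤a′) c∈ sa′∈ with m≤n⇒m<n∨m≡n a≤a′
  ... | inj₂ refl = image-down a c c∈ sa′∈
  ... | inj₁ a<a′ =
    let a′∈ = <-≤-trans (proj₁ sa′∈) (rowLen-antitone α₂ pα₂ a′) ,
              λ c<β → proj₂ c∈ (<-≤-trans c<β (antitone-≤ (rowLen-antitone β₂ pβ₂) (<⇒≤ a<a′)))
        (row< , col≤) = image-downward a a′ c a<a′ c∈ a′∈
        (row<′ , col≤′) = image-down a′ c a′∈ sa′∈
    in <-trans row< row<′ , ≤-trans col≤′ col≤

  image-southwest : ∀ p q → InSkew α₂ β₂ p → InSkew α₂ β₂ q → row p < row q × col p < col q →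
    row (image p) < row (image q) × col (image q) < col (image p)
  image-southwest (a , c) (a′ , c′) p∈ q∈ (a<a′ , c<c′) =
    let corner∈ = <-≤-trans (proj₁ q∈) (antitone-≤ (rowLen-antitone α₂ pα₂) (<⇒≤ a<a′)) ,
                  λ c′<β → proj₂ p∈ (<-trans c<c′ c′<β)
        (col< , row≤) = image-rightward a c c′ c<c′ p∈ corner∈
        (row< , col≤) = image-downward a a′ c′ a<a′ corner∈ q∈
    in ≤-<-trans row≤ row< , ≤-<-trans col≤ col<

  RowRuleAt-right : ∀ a c → InSkew α₂ β₂ (a , c) → InSkew α₂ β₂ (a , suc c) →
    RowRuleAt (a , c) → RowRuleAt (a , suc c)
  RowRuleAt-right a c c∈ sc∈ rule = ≤-trans rule (+-mono-≤ (+-monoˡ-≤ 1 (proj₂ (image-right a c c∈ sc∈))) (n≤1+n c))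

  RowRuleAt-down : ∀ a c → InSkew α₂ β₂ (a , c) → InSkew α₂ β₂ (suc a , c) →
    RowRuleAt (a , c) → RowRuleAt (suc a , c)
  RowRuleAt-down a c c∈ dc∈ rule = begin
    r + suc a                         ≡⟨ +-suc r a ⟩
    suc (r + a)                       ≤⟨ s≤s rule ⟩
    suc (row (image (a , c)) + 1 + c) ≤⟨ +-monoˡ-≤ c (+-monoˡ-≤ 1 (proj₁ (image-down a c c∈ dc∈))) ⟩
    row (image (suc a , c)) + 1 + c   ∎
    where open ≤-Reasoning

  content-strict : ∀ p q → InSkew α₂ β₂ p → InSkew α₂ β₂ q → label p < label q →
    ¬ (row p < row q × col p < col q) → suc (col q + row p) ≤ col p + row q
  content-strict p q p∈ q∈ lt ¬nw with L.label-<⇒≺ p q p∈ q∈ lt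
  ... | inj₂ (same-row , cq<cp) = +-mono-≤ cq<cp (≤-reflexive same-row)
  ... | inj₁ rp<rq with col p <? col q
  ...   | yes cp<cq = ⊥-elim (¬nw (rp<rq , cp<cq))
  ...   | no  cp≮cq = subst (_≤ col p + row q) (+-suc (col q) (row p)) (+-mono-≤ (≮⇒≥ cp≮cq) rp<rq)

  RowRuleAt-pullback : ∀ p q → InSkew α₂ β₂ p → InSkew α₂ β₂ q → label p < label q →
    row (image q) ≤ suc (row (image p)) →
    ¬ (row (image p) < row (image q) × col (image q) < col (image p)) →
    RowRuleAt q → RowRuleAt p
  RowRuleAt-pullback p q p∈ q∈ lt rows ¬sw rule =
    rowRule-transfer r (row p) (row q) (col p) (col q) (row (image p))
      (content-strict p q p∈ q∈ lt (¬sw ∘ image-southwest p q p∈ q∈))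
      (≤-trans rule (+-monoˡ-≤ (col q) (+-monoˡ-≤ 1 rows)))

  origin : Box → Box
  origin x = rl α₂ β₂ (preimage T n x)

  module _ {x : Box} (x∈ : InSkew β₁ α₁ x) where

    private
      preimage-spec′ : InRange n (preimage T n x) × T (preimage T n x) ≡ x
      preimage-spec′ = preimage-spec T n x (T-surjective x x∈)

    preimage∈ : InRange n (preimage T n x)
    preimage∈ = proj₁ preimage-spec′

    T-preimage : T (preimage T n x) ≡ x
    T-preimage = proj₂ preimage-spec′

    origin-inSkew : InSkew α₂ β₂ (origin x)
    origin-inSkew = L.rl-inSkew _ preimage∈

    label-origin : label (origin x) ≡ preimage T n x
    label-origin = L.label-rl _ preimage∈

    image-origin : image (origin x) ≡ x
    image-origin = trans (cong T label-origin) T-preimage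

  origin-image : ∀ b → InSkew α₂ β₂ b → origin (image b) ≡ b
  origin-image b b∈ = trans (cong (rl α₂ β₂) preimage≡label) (L.rl-label b b∈)
    where
    label∈ : InRange n (label b)
    label∈ = L.label-inRange b b∈
    spec : InRange n (preimage T n (image b)) × T (preimage T n (image b)) ≡ image b
    spec = preimage-spec T n (image b) (label b , label∈ , refl)
    preimage≡label : preimage T n (image b) ≡ label b
    preimage≡label = T-injective _ _ (proj₁ spec) label∈ (proj₂ spec)

  RowRuleAtCell : Box → Set
  RowRuleAtCell x = RowRuleAt (origin x)

  RowRuleAtCell-pullback : ∀ x y → (x∈ : InSkew β₁ α₁ x) (y∈ : InSkew β₁ α₁ y) →
    preimage T n x < preimage T n y → row y ≤ suc (row x) → ¬ (row x < row y × col y < col x) →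
    RowRuleAtCell y → RowRuleAtCell x
  RowRuleAtCell-pullback x y x∈ y∈ lt rows ¬sw =
    RowRuleAt-pullback (origin x) (origin y) (origin-inSkew x∈) (origin-inSkew y∈)
      (subst₂ _<_ (sym (label-origin x∈)) (sym (label-origin y∈)) lt)
      (subst₂ (λ u v → row v ≤ suc (row u)) (sym (image-origin x∈)) (sym (image-origin y∈)) rows)
      (subst₂ (λ u v → ¬ (row u < row v × col v < col u)) (sym (image-origin x∈)) (sym (image-origin y∈)) ¬sw)

  RowRuleAtCell-left : ∀ a c → InSkew β₁ α₁ (a , c) → InSkew β₁ α₁ (a , suc c) →
    RowRuleAtCell (a , suc c) → RowRuleAtCell (a , c)
  RowRuleAtCell-left a c c∈ sc∈ = RowRuleAtCell-pullback _ _ c∈ sc∈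
    (T-rowOrder _ _ (preimage∈ c∈) (preimage∈ sc∈)
      (trans (cong row (T-preimage c∈)) (sym (cong row (T-preimage sc∈))))
      (subst₂ (λ u v → col u < col v) (sym (T-preimage c∈)) (sym (T-preimage sc∈)) (n<1+n c)))
    (n≤1+n a) (λ (a<a , _) → <-irrefl refl a<a)

  RowRuleAtCell-up : ∀ a c → InSkew β₁ α₁ (a , c) → InSkew β₁ α₁ (suc a , c) →
    RowRuleAtCell (suc a , c) → RowRuleAtCell (a , c)
  RowRuleAtCell-up a c c∈ dc∈ = RowRuleAtCell-pullback _ _ c∈ dc∈
    (T-colOrder _ _ (preimage∈ c∈) (preimage∈ dc∈)
      (trans (cong col (T-preimage c∈)) (sym (cong col (T-preimage dc∈))))
      (subst₂ (λ u v → row u < row v) (sym (T-preimage c∈)) (sym (T-preimage dc∈)) (n<1+n a)))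
    ≤-refl (λ (_ , c<c) → <-irrefl refl c<c)

  RowRuleAt? : ∀ b → Dec (RowRuleAt b)
  RowRuleAt? b = r + row b ≤? row (image b) + 1 + col b

  module Λ₂ = Threshold α₂ β₂ pα₂ pβ₂ β₂⊆α₂ RowRuleAt RowRuleAt? RowRuleAt-right RowRuleAt-down

  module Λ₁ = Threshold β₁ α₁ pβ₁ pα₁ α₁⊆β₁ (¬_ ∘ RowRuleAtCell) (¬? ∘ RowRuleAt? ∘ origin)
    (λ a c c∈ sc∈ ¬rule rule → ¬rule (RowRuleAtCell-left a c c∈ sc∈ rule))
    (λ a c c∈ dc∈ ¬rule rule → ¬rule (RowRuleAtCell-up a c c∈ dc∈ rule))

  λ₁ λ₂ : List ℕ
  λ₁ = Λ₁.κ
  λ₂ = Λ₂.κ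

  image-inSkew : ∀ b → InSkew α₂ β₂ b → InSkew β₁ α₁ (image b)
  image-inSkew b b∈ = T-inSkew _ (L.label-inRange b b∈)

  RowRuleAt⇒cell : ∀ b → InSkew α₂ β₂ b → RowRuleAt b → RowRuleAtCell (image b)
  RowRuleAt⇒cell b b∈ = subst RowRuleAt (sym (origin-image b b∈))

  cell⇒RowRuleAt : ∀ b → InSkew α₂ β₂ b → RowRuleAtCell (image b) → RowRuleAt b
  cell⇒RowRuleAt b b∈ = subst RowRuleAt (origin-image b b∈)

  module Step₁ = Restriction β₁ α₁ α₂ β₂ T rw β₂⊆α₂ (proj₂ pβ₂) λ₁ α₁ α₂ λ₂
    Λ₂.κ⊆ν (proj₂ Λ₂.κ-isPartition) Λ₁.μ⊆κ (proj₂ pα₁) Λ₂.outer⊆ Λ₁.inner⊆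
    (λ b b∈ b∈′ → Λ₁.¬Q⇒inner _ (image-inSkew b b∈) (λ ¬rule → ¬rule (RowRuleAt⇒cell b b∈ (Λ₂.outer⇒Q b b∈′))))
    (λ b b∈ img∈ → Λ₂.Q⇒outer b b∈ (cell⇒RowRuleAt b b∈ (decidable-stable (RowRuleAt? _) (Λ₁.inner⇒¬Q _ img∈))))

  module Step₂ = Restriction β₁ α₁ α₂ β₂ T rw β₂⊆α₂ (proj₂ pβ₂) β₁ λ₁ λ₂ β₂
    Λ₂.μ⊆κ (proj₂ pβ₂) Λ₁.κ⊆ν (proj₂ Λ₁.κ-isPartition) Λ₂.inner⊆ Λ₁.outer⊆
    (λ b b∈ b∈′ → Λ₁.Q⇒outer _ (image-inSkew b b∈) (Λ₂.inner⇒¬Q b b∈′ ∘ cell⇒RowRuleAt b b∈))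
    (λ b b∈ img∈ → Λ₂.¬Q⇒inner b b∈ (Λ₁.outer⇒Q _ img∈ ∘ RowRuleAt⇒cell b b∈))

  T₁ T₂ : Tab
  T₁ = Step₁.restrict
  T₂ = Step₂.restrict

  T₁-rowRule : RowRule r α₂ λ₂ T₁
  T₁-rowRule j j∈ = Λ₂.outer⇒Q _ (RevLex.rl-inSkew α₂ λ₂ Λ₂.κ⊆ν (proj₂ Λ₂.κ-isPartition) j j∈)

  T₂-revRowRule : RevRowRule r λ₂ β₂ T₂
  T₂-revRowRule j j∈ = ≰⇒> (Λ₂.inner⇒¬Q _ (RevLex.rl-inSkew λ₂ β₂ Λ₂.μ⊆κ (proj₂ pβ₂) j j∈))

  rowRule-of-boxes : (∀ b → InSkew α₂ β₂ b → RowRuleAt b) → RowRule r α₂ β₂ T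
  rowRule-of-boxes all k k∈ =
    subst (λ i → r + row (rl α₂ β₂ k) ≤ row (T i) + 1 + col (rl α₂ β₂ k)) (L.label-rl k k∈)
      (all _ (L.rl-inSkew k k∈))

  revRowRule-of-boxes : (∀ b → InSkew α₂ β₂ b → ¬ RowRuleAt b) → RevRowRule r α₂ β₂ T
  revRowRule-of-boxes none k k∈ =
    subst (λ i → row (T i) + 1 + col (rl α₂ β₂ k) < r + row (rl α₂ β₂ k)) (L.label-rl k k∈)
      (≰⇒> (none _ (L.rl-inSkew k k∈)))

  source≢middle : ¬ RevRowRule r α₂ β₂ T → (α₁ , α₂) ≢ (λ₁ , λ₂)
  source≢middle ¬revRule eq = ¬revRule (revRowRule-of-boxes λ b b∈ rule →
    proj₂ (Λ₂.Q⇒outer b b∈ rule) (subst (λ μ → col b < rowLen μ (row b)) (cong proj₂ eq) (proj₁ b∈)))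

  middle≢target : ¬ RowRule r α₂ β₂ T → (λ₁ , λ₂) ≢ (β₁ , β₂)
  middle≢target ¬rowRule eq = ¬rowRule (rowRule-of-boxes λ b b∈ → decidable-stable (RowRuleAt? b) λ ¬rule →
    proj₂ b∈ (subst (λ μ → col b < rowLen μ (row b)) (cong proj₂ eq) (proj₁ (Λ₂.¬Q⇒inner b b∈ ¬rule))))

  composition : IsComposition α₁ λ₁ β₁ α₂ λ₂ β₂ T₁ T₂ T
  composition = (λ j k _ k∈ eq → sym (trans (cong image eq) (cong T (L.label-rl k k∈))))
              , (λ j k _ k∈ eq → sym (trans (cong image eq) (cong T (L.label-rl k k∈))))

mainTheorem11 : (r : ℕ) → 1 ≤ r →
    (α₁ α₂ β₁ β₂ : List ℕ) (T : Tab) →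
    Arrow (α₁ , α₂) (β₁ , β₂) T →
    ¬ RowRule r α₂ β₂ T →
    ¬ RevRowRule r α₂ β₂ T →
    ∃[ λ₁ ] ∃[ λ₂ ] ∃[ T₁ ] ∃[ T₂ ]
    (Arrow (α₁ , α₂) (λ₁ , λ₂) T₁ ×
    Arrow (λ₁ , λ₂) (β₁ , β₂) T₂ ×
    RowRule r α₂ λ₂ T₁ ×
    RevRowRule r λ₂ β₂ T₂ ×
    IsComposition α₁ λ₁ β₁ α₂ λ₂ β₂ T₁ T₂ T)
-- the construction does not need 1 ≤ r
mainTheorem11 r _ α₁ α₂ β₁ β₂ T ((pα₁ , pα₂) , (pβ₁ , pβ₂) , _ , α₁⊆β₁ , β₂⊆α₂ , rw) ¬rowRule ¬revRowRule =
  λ₁ , λ₂ , T₁ , T₂ ,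
  ((pα₁ , pα₂) , (Λ₁.κ-isPartition , Λ₂.κ-isPartition) , source≢middle ¬revRowRule ,
     Λ₁.μ⊆κ , Λ₂.κ⊆ν , Step₁.restrict-RW) ,
  ((Λ₁.κ-isPartition , Λ₂.κ-isPartition) , (pβ₁ , pβ₂) , middle≢target ¬rowRule ,
     Λ₁.κ⊆ν , Λ₂.μ⊆κ , Step₂.restrict-RW) ,
  T₁-rowRule , T₂-revRowRule , composition
  where open Factorisation r α₁ α₂ β₁ β₂ T pα₁ pα₂ pβ₁ pβ₂ α₁⊆β₁ β₂⊆α₂ rw
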